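{- Let $G$ be a bipartite graph with exactly three connected components $C$, $C'$, $C''$, where $C$ has at least two vertices. Then one can add two edges to $G$ so that the resulting graph $G'$ is a connected bipartite graph containing a spanning tree that has a leaf $w\in C'\cup C''$ with the property that if the two partite sets of $G'$ have different sizes, then $w$ lies in the smaller partite set of $G'$. -}

module Defs where

open import Data.Nat using (ℕ; _≤_; _<_; suc)
open import Data.Fin using (Fin)
open import Data.Bool using (Bool)
import Data.Bool.Properties as BoolP
open import Data.List using (List; []; _∷_; _++_; [_]; length; filter; allFin)
open import Data.List.Relation.Unary.Unique.Propositional using (Unique)
open import Data.List.Relation.Unary.Linked using (Linked)
open import Data.Product using (Σ; ∃; ∃-syntax; _×_; _,_)
open import Data.Sum using (_⊎_)
open import Relation.Nullary using (¬_)
open import Relation.Binary.PropositionalEquality using (_≡_; _≢_)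
open import Relation.Binary.Construct.Closure.ReflexiveTransitive using (Star)

Graph : ℕ → Set₁
Graph n = Fin n → Fin n → Set

record IsSimple {n : ℕ} (G : Graph n) : Set where
  field
    sym     : ∀ {u v} → G u v → G v u
    irrefl  : ∀ {u} → ¬ G u u

addEdge : ∀ {n} → Graph n → Fin n → Fin n → Graph n
addEdge G a b u v = G u v ⊎ ((u ≡ a × v ≡ b) ⊎ (u ≡ b × v ≡ a))

_⊆G_ : ∀ {n} → Graph n → Graph n → Set
H ⊆G G = ∀ {u v} → H u v → G u v

Reachable : ∀ {n} → Graph n → Fin n → Fin n → Set
Reachable G = Star G

Connected : ∀ {n} → Graph n → Set
Connected G = ∀ u v → Reachable G u v

ProperColouring : ∀ {n} → Graph n → (Fin n → Bool) → Set
ProperColouring G col = ∀ {u v} → G u v → col u ≢ col v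

Bipartite : ∀ {n} → Graph n → Set
Bipartite G = ∃[ col ] ProperColouring G col

-- comp labels the connected components of G by Fin k: every label is used,
-- and two vertices have the same label iff they are joined by a walk.
-- (So G has exactly k components, the i-th being comp⁻¹(i).)
ComponentLabelling : ∀ {n k} → Graph n → (Fin n → Fin k) → Set
ComponentLabelling G comp =
  (∀ i → ∃[ v ] comp v ≡ i) ×
  (∀ u v → (comp u ≡ comp v → Reachable G u v) × (Reachable G u v → comp u ≡ comp v))

HasCycle : ∀ {n} → Graph n → Set
HasCycle G = ∃[ x ] ∃[ xs ] (2 ≤ length xs × Unique (x ∷ xs) × Linked G (x ∷ xs ++ [ x ]))

Acyclic : ∀ {n} → Graph n → Set
Acyclic G = ¬ HasCycle G

IsSpanningTree : ∀ {n} → Graph n → Graph n → Set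
IsSpanningTree G T = IsSimple T × T ⊆G G × Connected T × Acyclic T

IsLeaf : ∀ {n} → Graph n → Fin n → Set
IsLeaf T w = ∃[ u ] (T w u × (∀ x → T w x → x ≡ u))

colourCount : ∀ {n} → (Fin n → Bool) → Bool → ℕ
colourCount {n} col b = length (filter (λ v → col v BoolP.≟ b) (allFin n))

NewEdge : ∀ {n} → Graph n → Fin n → Fin n → Set
NewEdge G a b = a ≢ b × ¬ G a b

DistinctPairs : ∀ {n} → Fin n → Fin n → Fin n → Fin n → Set
DistinctPairs a b c d = ¬ ((a ≡ c × b ≡ d) ⊎ (a ≡ d × b ≡ c))

{-# OPTIONS --safe #-}
-- Take spanning trees of the three components, given by parent pointers, and hang the
-- trees of C′ and C″ below vertices of C by the two new edges.  Since C is connected with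
-- at least two vertices it has vertices of both colours.  Recolour C′ and C″ so that
-- leaves w₁ ∈ C′ and w₂ ∈ C″ of their trees get opposite colours, and join each of the
-- two roots to a vertex of C of the other colour: the colouring stays proper, w₁ and w₂
-- stay leaves, and the colour class that is not larger contains one of them.
module Submission where

open import Defs
open import Data.Nat using (ℕ; _<_; _≤_; suc; s≤s)
open import Data.Nat.Properties using (<-irrefl; <-trans; ≤-reflexive; ≤-total; ≤∧≢⇒<)
open import Data.Fin using (Fin; zero; suc; _≟_)
open import Data.Bool using (Bool; true; false; not; _xor_)
open import Data.Bool.Properties using (not-injective; not-¬; ¬-not; xor-same; xor-inverseˡ)
  renaming (_≟_ to _≟ᵇ_)
open import Data.List using (List; []; _∷_; _++_; [_]; allFin)
open import Data.List.Relation.Unary.All as All using (All; []; _∷_)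
open import Data.List.Relation.Unary.AllPairs using (_∷_)
open import Data.List.Relation.Unary.Linked using (Linked; _∷_)
open import Data.List.Relation.Unary.Unique.Propositional using (Unique)
open import Data.List.Membership.Propositional.Properties using (∈-allFin)
open import Data.Product as Product using (Σ; Σ-syntax; ∃; ∃-syntax; _×_; _,_; proj₁; proj₂)
open import Data.Sum as Sum using (_⊎_; inj₁; inj₂)
open import Data.Empty using (⊥; ⊥-elim)
open import Function using (id; const)
open import Relation.Nullary using (¬_; yes; no)
open import Relation.Nullary.Decidable using (_⊎-dec_)
open import Relation.Unary using (Pred; Decidable; _⊆_)
open import Relation.Binary.Definitions using (Symmetric)
open import Relation.Binary.PropositionalEquality
  using (_≡_; _≢_; refl; sym; trans; cong; subst₂; ≢-sym)
open import Relation.Binary.Construct.Union using (_∪_)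
open import Relation.Binary.Construct.Closure.Symmetric as SymClosure using (SymClosure; fwd; bwd)
open import Relation.Binary.Construct.Closure.ReflexiveTransitive as Star using (Star; ε; _◅_; _◅◅_)

Functional : ∀ {n} → Graph n → Set
Functional P = ∀ {u v v′} → P u v → P u v′ → v ≡ v′

Childless : ∀ {n} → Graph n → Fin n → Set
Childless P w = ∀ {u} → ¬ P u w

Arc : ∀ {n} → Fin n → Fin n → Graph n
Arc a b u v = u ≡ a × v ≡ b

InSmallerClass : ∀ {n} → (Fin n → Bool) → Fin n → Set
InSmallerClass col w =
  colourCount col (col w) ≢ colourCount col (not (col w)) →
  colourCount col (col w) < colourCount col (not (col w))

module _ {n : ℕ} where

  functional-∪ : {P Q : Graph n} → Functional P → Functional Q →
                 (∀ {u v v′} → P u v → ¬ Q u v′) → Functional (P ∪ Q)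
  functional-∪ P-fun Q-fun disjoint (inj₁ p) (inj₁ p′) = P-fun p p′
  functional-∪ P-fun Q-fun disjoint (inj₁ p) (inj₂ q)  = ⊥-elim (disjoint p q)
  functional-∪ P-fun Q-fun disjoint (inj₂ q) (inj₁ p)  = ⊥-elim (disjoint p q)
  functional-∪ P-fun Q-fun disjoint (inj₂ q) (inj₂ q′) = Q-fun q q′

  arc-functional : ∀ {a b : Fin n} → Functional (Arc a b)
  arc-functional (refl , refl) (refl , refl) = refl

  addEdge-sym : ∀ {H : Graph n} {a b} → Symmetric H → Symmetric (addEdge H a b)
  addEdge-sym H-sym (inj₁ e)                = inj₁ (H-sym e)
  addEdge-sym H-sym (inj₂ (inj₁ (p , q))) = inj₂ (inj₂ (q , p))
  addEdge-sym H-sym (inj₂ (inj₂ (p , q))) = inj₂ (inj₁ (q , p))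

  addEdge-absorb : ∀ {H : Graph n} {a b} → H a b → H b a → addEdge H a b ⊆G H
  addEdge-absorb ab ba (inj₁ e)                   = e
  addEdge-absorb ab ba (inj₂ (inj₁ (refl , refl))) = ab
  addEdge-absorb ab ba (inj₂ (inj₂ (refl , refl))) = ba

  addEdge-proper : ∀ {H : Graph n} {col a b} → ProperColouring H col → col a ≢ col b →
                   ProperColouring (addEdge H a b) col
  addEdge-proper proper ca≢cb (inj₁ e)                   = proper e
  addEdge-proper proper ca≢cb (inj₂ (inj₁ (refl , refl))) = ca≢cb
  addEdge-proper proper ca≢cb (inj₂ (inj₂ (refl , refl))) = ≢-sym ca≢cb

  xor-cancelˡ : ∀ b {x y} → b xor x ≡ b xor y → x ≡ y
  xor-cancelˡ false eq = eq
  xor-cancelˡ true  eq = not-injective eq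

  xor-proper : ∀ {H : Graph n} {col} (f : Fin n → Bool) → ProperColouring H col →
               (∀ {u v} → H u v → f u ≡ f v) → ProperColouring H (λ v → f v xor col v)
  xor-proper {col = col} f proper f-const {u} {v} e eq =
    proper e (xor-cancelˡ (f u) (trans eq (cong (_xor col v) (sym (f-const e)))))

  ≤⇒inSmallerClass : ∀ {col : Fin n → Bool} {w b} → col w ≡ b →
                     colourCount col b ≤ colourCount col (not b) → InSmallerClass col w
  ≤⇒inSmallerClass refl = ≤∧≢⇒<

  oppositeColours⇒inSmallerClass : ∀ (col : Fin n → Bool) w₁ w₂ → col w₁ ≡ false → col w₂ ≡ true →
                                   InSmallerClass col w₁ ⊎ InSmallerClass col w₂
  oppositeColours⇒inSmallerClass col w₁ w₂ c₁ c₂ with ≤-total (colourCount col false) (colourCount col true)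
  ... | inj₁ f≤t = inj₁ (≤⇒inSmallerClass c₁ f≤t)
  ... | inj₂ t≤f = inj₂ (≤⇒inSmallerClass c₂ t≤f)

  spanningTree⇒connected : ∀ {H T : Graph n} → IsSpanningTree H T → Connected H
  spanningTree⇒connected (_ , T⊆H , T-connected , _) u v = Star.map T⊆H (T-connected u v)

  pendant⇒isLeaf : ∀ {P : Graph n} {w p} → Functional P → P w p → Childless P w →
                   IsLeaf (SymClosure P) w
  pendant⇒isLeaf P-fun wp childless = _ , fwd wp , λ where
    _ (fwd wx) → P-fun wx wp
    _ (bwd xw) → ⊥-elim (childless xw)

module _ {a} {A : Set a} where

  last : A → List A → A
  last x []       = x
  last _ (y ∷ ys) = last y ys

  penultimate : A → A → List A → A
  penultimate x _ []       = x
  penultimate _ y (z ∷ zs) = penultimate y z zs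

  last-++ : ∀ x ys z → last x (ys ++ [ z ]) ≡ z
  last-++ x []       z = refl
  last-++ x (y ∷ ys) z = last-++ y ys z

  penultimate-++ : ∀ x y zs w → penultimate x y (zs ++ [ w ]) ≡ last y zs
  penultimate-++ x y []       w = refl
  penultimate-++ x y (z ∷ zs) w = penultimate-++ y z zs w

  All-last : ∀ {p} {P : Pred A p} {x ys} → All P (x ∷ ys) → P (last x ys)
  All-last (px ∷ [])  = px
  All-last (_ ∷ pys@(_ ∷ _)) = All-last pys

  data NonBacktracking : List A → Set a where
    single : ∀ {x y} → NonBacktracking (x ∷ y ∷ [])
    turn   : ∀ {x y z zs} → x ≢ z → NonBacktracking (y ∷ z ∷ zs) →
             NonBacktracking (x ∷ y ∷ z ∷ zs)

  unique⇒closedWalk-nonBacktracking : ∀ {x y z zs w} → Unique (x ∷ y ∷ z ∷ zs) →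
                                      All (w ≢_) (y ∷ z ∷ zs) →
                                      NonBacktracking (x ∷ y ∷ z ∷ zs ++ [ w ])
  unique⇒closedWalk-nonBacktracking {zs = []} ((_ ∷ x≢z ∷ _) ∷ _) (w≢y ∷ _) =
    turn x≢z (turn (≢-sym w≢y) single)
  unique⇒closedWalk-nonBacktracking {zs = _ ∷ _} ((_ ∷ x≢z ∷ _) ∷ unique) (_ ∷ w∉) =
    turn x≢z (unique⇒closedWalk-nonBacktracking unique w∉)

-- A step x → y of a walk in SymClosure P goes up if P x y and down if P y x.  Since P is
-- functional, a non-backtracking walk never goes up right after going down: it goes up and
-- then down, so by the rank a closed one must come back along its first edge.
module _ {n} {P : Graph n} (P-fun : Functional P)
         (rank : Fin n → ℕ) (rank-descending : ∀ {u v} → P u v → rank v < rank u) where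

  private
    T : Graph n
    T = SymClosure P

  downward-walk : ∀ {x y zs} → NonBacktracking (x ∷ y ∷ zs) → Linked T (x ∷ y ∷ zs) → P y x →
                  rank x < rank (last y zs) × P (last y zs) (penultimate x y zs)
  downward-walk single                   _                          down = rank-descending down , down
  downward-walk (turn x≢z _)             (_ ∷ fwd up ∷ _)           down = ⊥-elim (x≢z (P-fun down up))
  downward-walk (turn _ nonBacktracking) (_ ∷ walk@(bwd down′ ∷ _)) down =
    Product.map₁ (<-trans (rank-descending down)) (downward-walk nonBacktracking walk down′)

  upward-walk : ∀ {x y zs} → NonBacktracking (x ∷ y ∷ zs) → Linked T (x ∷ y ∷ zs) → P x y →
                rank (last y zs) < rank x ⊎ P (last y zs) (penultimate x y zs)
  upward-walk single                   _                          up = inj₁ (rank-descending up)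
  upward-walk (turn _ nonBacktracking) (_ ∷ walk@(fwd up′ ∷ _))  up =
    Sum.map₁ (λ r< → <-trans r< (rank-descending up)) (upward-walk nonBacktracking walk up′)
  upward-walk (turn _ nonBacktracking) (_ ∷ walk@(bwd down ∷ _)) up =
    inj₂ (proj₂ (downward-walk nonBacktracking walk down))

  closedWalk-returnsAlongFirstEdge : ∀ {x y zs} → NonBacktracking (x ∷ y ∷ zs ++ [ x ]) →
                                     Linked T (x ∷ y ∷ zs ++ [ x ]) → y ≡ last y zs
  closedWalk-returnsAlongFirstEdge {x} {y} {zs} nonBacktracking walk@(bwd down ∷ _) =
    ⊥-elim (<-irrefl (cong rank (sym (last-++ y zs x)))
                     (proj₁ (downward-walk nonBacktracking walk down)))
  closedWalk-returnsAlongFirstEdge {x} {y} {zs} nonBacktracking walk@(fwd up ∷ _)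
    with upward-walk nonBacktracking walk up
  ... | inj₁ r< = ⊥-elim (<-irrefl (cong rank (last-++ y zs x)) r<)
  ... | inj₂ down = P-fun up (subst₂ P (last-++ y zs x) (penultimate-++ x y zs x) down)

  ranked⇒acyclic : Acyclic T
  ranked⇒acyclic (_ , []         , ()     , _)
  ranked⇒acyclic (_ , _ ∷ []     , s≤s () , _)
  ranked⇒acyclic (_ , y ∷ z ∷ zs , _      , unique@(x∉ ∷ y∉ ∷ _) , walk) =
    All-last y∉ (closedWalk-returnsAlongFirstEdge {zs = z ∷ zs}
                   (unique⇒closedWalk-nonBacktracking unique x∉) walk)

pathLength : ∀ {n} {P : Graph n} {u v} → Star P u v → ℕ
pathLength ε       = 0
pathLength (_ ◅ p) = suc (pathLength p)

module _ {n} {P : Graph n} (P-fun : Functional P) {r} (r-orphan : ∀ {v} → ¬ P r v) where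

  pathLength-unique : ∀ {u} (p q : Star P u r) → pathLength p ≡ pathLength q
  pathLength-unique ε        ε        = refl
  pathLength-unique ε        (e ◅ _)  = ⊥-elim (r-orphan e)
  pathLength-unique (e ◅ _)  ε        = ⊥-elim (r-orphan e)
  pathLength-unique (e ◅ p)  (e′ ◅ q) with P-fun e e′
  ... | refl = cong suc (pathLength-unique p q)

  pathLength-descending : ∀ {u v} → P u v → (p : Star P u r) (q : Star P v r) →
                          pathLength q < pathLength p
  pathLength-descending uv ε         q = ⊥-elim (r-orphan uv)
  pathLength-descending uv (uv′ ◅ p) q with P-fun uv uv′
  ... | refl = s≤s (≤-reflexive (pathLength-unique q p))

-- The leaf is carried along because attaching a new vertex makes that vertex a leaf.
record RootedTree {n} (H : Graph n) (root : Fin n) : Set₁ where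
  field
    Vertex            : Fin n → Set
    vertex?           : Decidable Vertex
    Parent            : Graph n
    parent-functional : Functional Parent
    parent-edge       : Parent ⊆G H
    parent-source     : ∀ {u v} → Parent u v → Vertex u
    parent-target     : ∀ {u v} → Parent u v → Vertex v
    root-vertex       : Vertex root
    root-orphan       : ∀ {v} → ¬ Parent root v
    path-to-root      : ∀ {u} → Vertex u → Star Parent u root
    leaf              : Fin n
    leaf-vertex       : Vertex leaf
    leaf-childless    : Childless Parent leaf

open RootedTree

module _ {n} {H : Graph n} where

  singleton : ∀ r → RootedTree H r
  singleton r = record
    { Vertex = _≡ r ; vertex? = _≟ r ; Parent = λ _ _ → ⊥
    ; parent-functional = λ () ; parent-edge = λ () ; parent-source = λ () ; parent-target = λ ()
    ; root-vertex = refl ; root-orphan = λ () ; path-to-root = λ { refl → ε }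
    ; leaf = r ; leaf-vertex = refl ; leaf-childless = λ () }

  weaken : ∀ {H′ : Graph n} {r} → H ⊆G H′ → RootedTree H r → RootedTree H′ r
  weaken H⊆H′ t = record
    { Vertex = Vertex t ; vertex? = vertex? t ; Parent = Parent t
    ; parent-functional = parent-functional t ; parent-edge = λ p → H⊆H′ (parent-edge t p)
    ; parent-source = parent-source t ; parent-target = parent-target t
    ; root-vertex = root-vertex t ; root-orphan = root-orphan t ; path-to-root = path-to-root t
    ; leaf = leaf t ; leaf-vertex = leaf-vertex t ; leaf-childless = leaf-childless t }

  module _ (H-sym : Symmetric H) {r} (t : RootedTree H r) (spanning : ∀ v → Vertex t v) where

    private
      depth : Fin n → ℕ
      depth v = pathLength (path-to-root t (spanning v))

      depth-descending : ∀ {u v} → Parent t u v → depth v < depth u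
      depth-descending {u} {v} uv =
        pathLength-descending (parent-functional t) (root-orphan t) uv
          (path-to-root t (spanning u)) (path-to-root t (spanning v))

      irreflexive : ∀ {u} → ¬ SymClosure (Parent t) u u
      irreflexive (fwd uu) = <-irrefl refl (depth-descending uu)
      irreflexive (bwd uu) = <-irrefl refl (depth-descending uu)

      connected : Connected (SymClosure (Parent t))
      connected u v = up u ◅◅ Star.reverse (SymClosure.symmetric _) (up v)
        where up = λ w → Star.map fwd (path-to-root t (spanning w))

    rootedTree⇒spanningTree : IsSpanningTree H (SymClosure (Parent t))
    rootedTree⇒spanningTree =
        record { sym = SymClosure.symmetric _ ; irrefl = irreflexive }
      , SymClosure.fold H-sym (parent-edge t)
      , connected
      , ranked⇒acyclic (parent-functional t) depth depth-descending

module Glue {n} {H : Graph n} {r r′ x : Fin n} (t : RootedTree H r) (t′ : RootedTree H r′)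
            (x∈t : Vertex t x) (disjoint : ∀ {v} → Vertex t v → ¬ Vertex t′ v) where

  Parent′ : Graph n
  Parent′ = Parent t′ ∪ Arc r′ x

  Glued : Graph n
  Glued = Parent t ∪ Parent′

  private

    source′ : ∀ {u v} → Parent′ u v → Vertex t′ u
    source′ (inj₁ p)          = parent-source t′ p
    source′ (inj₂ (refl , _)) = root-vertex t′

    path : ∀ {v} → Vertex t v ⊎ Vertex t′ v → Star Glued v r
    path (inj₁ v∈) = Star.map inj₁ (path-to-root t v∈)
    path (inj₂ v∈) = Star.map (λ p → inj₂ (inj₁ p)) (path-to-root t′ v∈)
                  ◅◅ inj₂ (inj₂ (refl , refl)) ◅ Star.map inj₁ (path-to-root t x∈t)

  childless-right : ∀ {w} → Vertex t′ w → Childless (Parent t′) w → Childless Glued w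
  childless-right w∈ childless (inj₁ p)                 = disjoint (parent-target t p) w∈
  childless-right w∈ childless (inj₂ (inj₁ p))          = childless p
  childless-right w∈ childless (inj₂ (inj₂ (_ , refl))) = disjoint x∈t w∈

  childless-left : ∀ {w} → Vertex t w → w ≢ x → Childless (Parent t) w → Childless Glued w
  childless-left w∈ w≢x childless (inj₁ p)                = childless p
  childless-left w∈ w≢x childless (inj₂ (inj₁ p))         = disjoint w∈ (parent-target t′ p)
  childless-left w∈ w≢x childless (inj₂ (inj₂ (_ , w≡x))) = w≢x w≡x

  has-parent-right : ∀ {w} → Vertex t′ w → ∃ (Glued w)
  has-parent-right w∈ with path-to-root t′ w∈
  ... | ε     = x , inj₂ (inj₂ (refl , refl))
  ... | p ◅ _ = _ , inj₂ (inj₁ p)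

  tree : RootedTree (addEdge H r′ x) r
  tree = record
    { Vertex = λ v → Vertex t v ⊎ Vertex t′ v
    ; vertex? = λ v → vertex? t v ⊎-dec vertex? t′ v
    ; Parent = Glued
    ; parent-functional =
        functional-∪ {P = Parent t} {Q = Parent′} (parent-functional t)
          (functional-∪ {P = Parent t′} {Q = Arc r′ x} (parent-functional t′) arc-functional
             λ { p (refl , _) → root-orphan t′ p })
          (λ p q → disjoint (parent-source t p) (source′ q))
    ; parent-edge = λ where
        (inj₁ p)        → inj₁ (parent-edge t p)
        (inj₂ (inj₁ p)) → inj₁ (parent-edge t′ p)
        (inj₂ (inj₂ a)) → inj₂ (inj₁ a)
    ; parent-source = λ where
        (inj₁ p) → inj₁ (parent-source t p)
        (inj₂ q) → inj₂ (source′ q)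
    ; parent-target = λ where
        (inj₁ p)                 → inj₁ (parent-target t p)
        (inj₂ (inj₁ p))          → inj₂ (parent-target t′ p)
        (inj₂ (inj₂ (_ , refl))) → inj₁ x∈t
    ; root-vertex = inj₁ (root-vertex t)
    ; root-orphan = λ where
        (inj₁ p) → root-orphan t p
        (inj₂ q) → disjoint (root-vertex t) (source′ q)
    ; path-to-root = path
    ; leaf = leaf t′
    ; leaf-vertex = inj₂ (leaf-vertex t′)
    ; leaf-childless = childless-right (leaf-vertex t′) (leaf-childless t′)
    }

module Growth {n} {H : Graph n} (H-sym : Symmetric H) {r : Fin n} where

  attach : ∀ {x y} (t : RootedTree H r) → Vertex t x → ¬ Vertex t y → H y x → RootedTree H r
  attach {y = y} t x∈ y∉ yx =
    weaken (addEdge-absorb {H = H} yx (H-sym yx)) (Glue.tree t (singleton y) x∈ y-new)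
    where
      y-new : ∀ {v} → Vertex t v → v ≢ y
      y-new v∈ refl = y∉ v∈

  grow : ∀ {x v} (t : RootedTree H r) → Vertex t x → Star H x v →
         Σ[ t′ ∈ RootedTree H r ] (Vertex t′ v × Vertex t ⊆ Vertex t′)
  grow t x∈ ε = t , x∈ , id
  grow t x∈ (_◅_ {j = y} xy walk) with vertex? t y
  ... | yes y∈ = grow t y∈ walk
  ... | no  y∉ with grow (attach t x∈ y∉ (H-sym xy)) (inj₂ refl) walk
  ...   | t′ , v∈ , t⊆t′ = t′ , v∈ , λ u∈ → t⊆t′ (inj₁ u∈)

  module _ (K : Fin n → Set) (K? : Decidable K) (reach : ∀ {v} → K v → Star H r v) where

    private
      growAll : (vs : List (Fin n)) → Σ[ t ∈ RootedTree H r ] All (λ v → K v → Vertex t v) vs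
      growAll [] = singleton r , []
      growAll (v ∷ vs) with growAll vs | K? v
      ... | t , covered | no ¬k = t , (λ k → ⊥-elim (¬k k)) ∷ covered
      ... | t , covered | yes k with grow t (root-vertex t) (reach k)
      ...   | t′ , v∈ , t⊆t′ = t′ , const v∈ ∷ All.map (λ f k → t⊆t′ (f k)) covered

    spanningRootedTree : Σ[ t ∈ RootedTree H r ] K ⊆ Vertex t
    spanningRootedTree with growAll (allFin n)
    ... | t , covered = t , λ {v} → All.lookup covered (∈-allFin v)

module ThreeComponents {n} (G : Graph n) (simple : IsSimple G) (col : Fin n → Bool)
                       (proper : ProperColouring G col)
                       (comp : Fin n → Fin 3) (labelling : ComponentLabelling G comp) where

  representative : Fin 3 → Fin n
  representative k = proj₁ (proj₁ labelling k)

  representative-comp : ∀ k → comp (representative k) ≡ k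
  representative-comp k = proj₂ (proj₁ labelling k)

  sameComp⇒reachable : ∀ {u v} → comp u ≡ comp v → Reachable G u v
  sameComp⇒reachable {u} {v} = proj₁ (proj₂ labelling u v)

  reachable⇒sameComp : ∀ {u v} → Reachable G u v → comp u ≡ comp v
  reachable⇒sameComp {u} {v} = proj₂ (proj₂ labelling u v)

  edge⇒sameComp : ∀ {u v} → G u v → comp u ≡ comp v
  edge⇒sameComp e = reachable⇒sameComp (e ◅ ε)

  label-≢ : ∀ {u i j} → comp u ≡ i → i ≢ j → comp u ≢ j
  label-≢ cu i≢j eq = i≢j (trans (sym cu) eq)

  comp-≢ : ∀ {u v i j} → comp u ≡ i → comp v ≡ j → i ≢ j → comp u ≢ comp v
  comp-≢ cu cv i≢j eq = label-≢ cu i≢j (trans eq cv)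

  differentComp⇒newEdge : ∀ {a b} → comp a ≢ comp b → NewEdge G a b
  differentComp⇒newEdge ca≢cb = (λ a≡b → ca≢cb (cong comp a≡b)) , (λ e → ca≢cb (edge⇒sameComp e))

  bothColours : ∀ {u v} → u ≢ v → comp u ≡ comp v → ∀ β → ∃[ a ] (comp a ≡ comp u × col a ≡ β)
  bothColours {u} u≢v cu≡cv β with sameComp⇒reachable cu≡cv
  ... | ε = ⊥-elim (u≢v refl)
  ... | _◅_ {j = u′} e _ with col u ≟ᵇ β
  ...   | yes cu≡β = u , refl , cu≡β
  ...   | no  cu≢β =
    u′ , sym (edge⇒sameComp e) , not-injective (trans (sym (¬-not (proper e))) (¬-not cu≢β))

  record ComponentTree (k : Fin 3) : Set₁ where
    field
      tree        : RootedTree G (representative k)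
      vertex⇒comp : ∀ {v} → Vertex tree v → comp v ≡ k
      comp⇒vertex : ∀ {v} → comp v ≡ k → Vertex tree v

  open ComponentTree

  componentTree : ∀ k → ComponentTree k
  componentTree k
    with Growth.spanningRootedTree (IsSimple.sym simple) (λ v → comp v ≡ k) (λ v → comp v ≟ k)
           (λ ck → sameComp⇒reachable (trans (representative-comp k) (sym ck)))
  ... | t , covers = record
    { tree = t
    ; vertex⇒comp = λ v∈ →
        trans (reachable⇒sameComp (Star.map (parent-edge t) (path-to-root t v∈)))
              (representative-comp k)
    ; comp⇒vertex = covers }

  disjoint : ∀ {i j v} → i ≢ j → (Tᵢ : ComponentTree i) (Tⱼ : ComponentTree j) →
             Vertex (tree Tᵢ) v → ¬ Vertex (tree Tⱼ) v
  disjoint i≢j Tᵢ Tⱼ v∈ᵢ v∈ⱼ = i≢j (trans (sym (vertex⇒comp Tᵢ v∈ᵢ)) (vertex⇒comp Tⱼ v∈ⱼ))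

  module Construction {u₀ v₀ : Fin n} (u₀≢v₀ : u₀ ≢ v₀) (cu₀ : comp u₀ ≡ zero) (cv₀ : comp v₀ ≡ zero)
    where

    T₀ : ComponentTree zero
    T₀ = componentTree zero
    T₁ : ComponentTree (suc zero)
    T₁ = componentTree (suc zero)
    T₂ : ComponentTree (suc (suc zero))
    T₂ = componentTree (suc (suc zero))

    r₁ r₂ w₁ w₂ : Fin n
    r₁ = representative (suc zero)
    r₂ = representative (suc (suc zero))
    w₁ = leaf (tree T₁)
    w₂ = leaf (tree T₂)

    cw₁ : comp w₁ ≡ suc zero
    cw₁ = vertex⇒comp T₁ (leaf-vertex (tree T₁))

    cw₂ : comp w₂ ≡ suc (suc zero)
    cw₂ = vertex⇒comp T₂ (leaf-vertex (tree T₂))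

    flipped : Fin 3 → Bool
    flipped zero             = false
    flipped (suc zero)       = col w₁
    flipped (suc (suc zero)) = not (col w₂)

    colour : Fin n → Bool
    colour v = flipped (comp v) xor col v

    colour-w₁ : colour w₁ ≡ false
    colour-w₁ = trans (cong (λ k → flipped k xor col w₁) cw₁) (xor-same (col w₁))

    colour-w₂ : colour w₂ ≡ true
    colour-w₂ = trans (cong (λ k → flipped k xor col w₂) cw₂) (xor-inverseˡ (col w₂))

    colour-C : ∀ {a} → comp a ≡ zero → colour a ≡ col a
    colour-C {a} ca = cong (λ k → flipped k xor col a) ca

    anchored : ∀ v → ∃[ a ] (comp a ≡ comp u₀ × col a ≡ not (colour v))
    anchored v = bothColours u₀≢v₀ (trans cu₀ (sym cv₀)) (not (colour v))

    anchor : Fin n → Fin n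
    anchor v = proj₁ (anchored v)

    anchor-comp : ∀ v → comp (anchor v) ≡ zero
    anchor-comp v = trans (proj₁ (proj₂ (anchored v))) cu₀

    anchor-colour : ∀ v → colour v ≢ colour (anchor v)
    anchor-colour v eq =
      not-¬ refl (trans eq (trans (colour-C (anchor-comp v)) (proj₂ (proj₂ (anchored v)))))

    a₁ a₂ : Fin n
    a₁ = anchor r₁
    a₂ = anchor r₂

    G′ : Graph n
    G′ = addEdge (addEdge G r₁ a₁) r₂ a₂

    newEdge₁ : NewEdge G r₁ a₁
    newEdge₁ = differentComp⇒newEdge (comp-≢ (representative-comp _) (anchor-comp r₁) λ ())

    newEdge₂ : NewEdge G r₂ a₂
    newEdge₂ = differentComp⇒newEdge (comp-≢ (representative-comp _) (anchor-comp r₂) λ ())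

    distinctPairs : DistinctPairs r₁ a₁ r₂ a₂
    distinctPairs (inj₁ (r₁≡r₂ , _)) =
      comp-≢ (representative-comp _) (representative-comp _) (λ ()) (cong comp r₁≡r₂)
    distinctPairs (inj₂ (r₁≡a₂ , _)) =
      comp-≢ (representative-comp _) (anchor-comp r₂) (λ ()) (cong comp r₁≡a₂)

    colour-proper₀ : ProperColouring G colour
    colour-proper₀ = xor-proper (λ v → flipped (comp v)) proper (λ e → cong flipped (edge⇒sameComp e))

    colour-proper : ProperColouring G′ colour
    colour-proper = addEdge-proper {H = addEdge G r₁ a₁}
                      (addEdge-proper {H = G} colour-proper₀ (anchor-colour r₁)) (anchor-colour r₂)

    module Tree₀₁ = Glue (tree T₀) (tree T₁) (comp⇒vertex T₀ (anchor-comp r₁))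
                         (disjoint (λ ()) T₀ T₁)

    disjoint₀₁-₂ : ∀ {v} → Vertex Tree₀₁.tree v → ¬ Vertex (tree T₂) v
    disjoint₀₁-₂ (inj₁ v∈) = disjoint (λ ()) T₀ T₂ v∈
    disjoint₀₁-₂ (inj₂ v∈) = disjoint (λ ()) T₁ T₂ v∈

    module Tree₀₁₂ = Glue Tree₀₁.tree (weaken inj₁ (tree T₂)) (inj₁ (comp⇒vertex T₀ (anchor-comp r₂)))
                          disjoint₀₁-₂

    spans : ∀ v → Vertex Tree₀₁₂.tree v
    spans v with comp v in cv
    ... | zero           = inj₁ (inj₁ (comp⇒vertex T₀ cv))
    ... | suc zero       = inj₁ (inj₂ (comp⇒vertex T₁ cv))
    ... | suc (suc zero) = inj₂ (comp⇒vertex T₂ cv)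

    T : Graph n
    T = SymClosure (Parent Tree₀₁₂.tree)

    T-spanning : IsSpanningTree G′ T
    T-spanning =
      rootedTree⇒spanningTree (addEdge-sym (addEdge-sym (IsSimple.sym simple))) Tree₀₁₂.tree spans

    G′-connected : Connected G′
    G′-connected = spanningTree⇒connected T-spanning

    leaf-w₁ : IsLeaf T w₁
    leaf-w₁ = pendant⇒isLeaf (parent-functional Tree₀₁₂.tree)
      (inj₁ (proj₂ (Tree₀₁.has-parent-right (leaf-vertex (tree T₁)))))
      (Tree₀₁₂.childless-left (leaf-vertex Tree₀₁.tree)
        (λ w₁≡a₂ → comp-≢ cw₁ (anchor-comp r₂) (λ ()) (cong comp w₁≡a₂))
        (leaf-childless Tree₀₁.tree))

    leaf-w₂ : IsLeaf T w₂
    leaf-w₂ = pendant⇒isLeaf (parent-functional Tree₀₁₂.tree)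
      (proj₂ (Tree₀₁₂.has-parent-right (leaf-vertex (tree T₂))))
      (leaf-childless Tree₀₁₂.tree)

    leafInSmallerClass : ∃[ w ] (IsLeaf T w × comp w ≢ zero × InSmallerClass colour w)
    leafInSmallerClass with oppositeColours⇒inSmallerClass colour w₁ w₂ colour-w₁ colour-w₂
    ... | inj₁ smaller = w₁ , leaf-w₁ , label-≢ cw₁ (λ ()) , smaller
    ... | inj₂ smaller = w₂ , leaf-w₂ , label-≢ cw₂ (λ ()) , smaller

lemma2p3 : ∀ {n} (G : Graph n) → IsSimple G → Bipartite G
    → (comp : Fin n → Fin 3) → ComponentLabelling G comp
    → (∃[ u ] ∃[ v ] (u ≢ v × comp u ≡ zero × comp v ≡ zero))
    → ∃[ a ] ∃[ b ] ∃[ c ] ∃[ d ]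
        (NewEdge G a b × NewEdge G c d × DistinctPairs a b c d
        × Connected (addEdge (addEdge G a b) c d)
        × Σ (Fin n → Bool) λ col → ProperColouring (addEdge (addEdge G a b) c d) col
          × ∃[ T ] (IsSpanningTree (addEdge (addEdge G a b) c d) T
            × ∃[ w ] (IsLeaf T w × comp w ≢ zero
              × (colourCount col (col w) ≢ colourCount col (not (col w))
                 → colourCount col (col w) < colourCount col (not (col w))))))
lemma2p3 G simple (col , proper) comp labelling (u , v , u≢v , cu , cv) =
    r₁ , a₁ , r₂ , a₂ , newEdge₁ , newEdge₂ , distinctPairs , G′-connected
  , colour , colour-proper , T , T-spanning , leafInSmallerClass
  where open ThreeComponents G simple col proper comp labelling
        open Construction u≢v cu cv
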